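{- If $G$ is a finite simple graph of order $n\ge3$ and $q(G)$ has $n-1$ nonzero terms, then $q(G)=2x+x^2+\cdots+x^{n-1}$ and $G$ is the star $K_{1,n-1}$ on $n$ vertices.
   Context: The interlace polynomial $q$ is the unique map from finite simple graphs to $\mathbb{Z}[x]$ with $q(E_n)=x^n$ for the edgeless graph $E_n$ on $n$ vertices and $q(G)=q(G-a)+q(G^{ab}-b)$ for every edge $ab$ of $G$; here the pivot $G^{ab}$ is obtained by partitioning the vertices other than $a,b$ into (1) adjacent to $a$ only, (2) adjacent to $b$ only, (3) adjacent to both, (4) adjacent to neither, and toggling the adjacency of every pair $\{x,y\}$ with $x,y$ in two different classes among (1),(2),(3). -}

module Defs where

open import Data.Bool using (Bool; true; false; _∧_; _∨_; not; _xor_; if_then_else_)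
open import Data.Nat using (ℕ; zero; suc; _≡ᵇ_; _∸_)
open import Data.Integer using (ℤ; +_; _+_)
open import Data.Fin using (Fin; toℕ; punchIn; _≟_)
open import Data.List using (List; []; _∷_; _++_; replicate; filterᵇ; cartesianProduct; allFin; [_])
open import Data.Maybe using (Maybe; just; nothing)
open import Data.Product using (_×_; _,_)
open import Relation.Nullary.Decidable using (⌊_⌋)
open import Relation.Binary.PropositionalEquality using (_≡_; refl)
open import Function.Bundles using (_↔_; Inverse)

Adj : ℕ → Set
Adj n = Fin n → Fin n → Bool

record SimpleGraph (n : ℕ) : Set where
  field
    adj    : Adj n
    sym    : ∀ x y → adj x y ≡ adj y x
    irrefl : ∀ x → adj x x ≡ false
open SimpleGraph public

delete : ∀ {n} → Fin (suc n) → Adj (suc n) → Adj n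
delete a g x y = g (punchIn a x) (punchIn a y)

-- Pivot G^{ab}: for x,y ∉ {a,b}, classify by (x ~ a, x ~ b);
-- class (false,false) is class (4). Toggle x,y iff both are in classes
-- (1),(2),(3) and their classes differ.
pivot : ∀ {n} → Adj n → Fin n → Fin n → Adj n
pivot g a b x y =
  if isAB x ∨ isAB y then g x y else (g x y xor toggle)
  where
  isAB : _ → Bool
  isAB z = ⌊ z ≟ a ⌋ ∨ ⌊ z ≟ b ⌋
  inClass123 : _ → Bool
  inClass123 z = g a z ∨ g b z
  sameClass : Bool
  sameClass = not (g a x xor g a y) ∧ not (g b x xor g b y)
  toggle : Bool
  toggle = inClass123 x ∧ inClass123 y ∧ not sameClass

edges : ∀ {n} → Adj n → List (Fin n × Fin n)
edges {n} g = filterᵇ (λ { (a , b) → g a b }) (cartesianProduct (allFin n) (allFin n))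

firstEdge : ∀ {n} → Adj n → Maybe (Fin n × Fin n)
firstEdge g with edges g
... | []      = nothing
... | e ∷ _   = just e

-- Polynomials in ℤ[x] as coefficient lists (constant term first);
-- trailing zeros are allowed, equality is coefficientwise.

Poly : Set
Poly = List ℤ

_⊕_ : Poly → Poly → Poly
[]       ⊕ q        = q
(a ∷ p)  ⊕ []       = a ∷ p
(a ∷ p)  ⊕ (b ∷ q)  = (a + b) ∷ (p ⊕ q)

xpow : ℕ → Poly
xpow k = replicate k (+ 0) ++ [ + 1 ]

coeff : Poly → ℕ → ℤ
coeff []      _       = + 0
coeff (a ∷ p) zero    = a
coeff (a ∷ p) (suc i) = coeff p i

_≈P_ : Poly → Poly → Set
p ≈P q = ∀ i → coeff p i ≡ coeff q i

isZeroℤ : ℤ → Bool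
isZeroℤ (+ zero) = true
isZeroℤ _        = false

nonzeroTerms : Poly → ℕ
nonzeroTerms []      = 0
nonzeroTerms (a ∷ p) = if isZeroℤ a then nonzeroTerms p else suc (nonzeroTerms p)

-- The interlace polynomial, computed by the recursion
--   q(E_n) = x^n,   q(G) = q(G - a) + q(G^{ab} - b)  for an edge ab,
-- always using the first edge in lexicographic order. (By the
-- well-definedness theorem, the result does not depend on the edge.)

qAdj : (n : ℕ) → Adj n → Poly
qAdj zero    g = xpow 0
qAdj (suc n) g with firstEdge g
... | nothing      = xpow (suc n)
... | just (a , b) = qAdj n (delete a g) ⊕ qAdj n (delete b (pivot g a b))

q : ∀ {n} → SimpleGraph n → Poly
q {n} G = qAdj n (adj G)

starPoly : ℕ → Poly
starPoly n = + 0 ∷ + 2 ∷ replicate (n ∸ 2) (+ 1)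

isCentre : ∀ {n} → Fin n → Bool
isCentre x = toℕ x ≡ᵇ 0

starAdj : ∀ {n} → Adj n
starAdj x y = (isCentre x ∧ not (isCentre y)) ∨ (isCentre y ∧ not (isCentre x))

private
  starSym : ∀ {n} (x y : Fin n) → starAdj x y ≡ starAdj y x
  starSym x y with isCentre x | isCentre y
  ... | true  | true  = refl
  ... | true  | false = refl
  ... | false | true  = refl
  ... | false | false = refl

  starIrr : ∀ {n} (x : Fin n) → starAdj x x ≡ false
  starIrr x with isCentre x
  ... | true  = refl
  ... | false = refl

star : (n : ℕ) → SimpleGraph n
star n = record { adj = starAdj ; sym = starSym ; irrefl = starIrr }

_≅_ : ∀ {n} → SimpleGraph n → SimpleGraph n → Set
_≅_ {n} G H = Σ' (Fin n ↔ Fin n) (λ σ → ∀ x y → adj G (Inverse.to σ x) (Inverse.to σ y) ≡ adj H x y)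
  where
  open import Data.Product using () renaming (Σ to Σ')

module Submission where

-- q(G) has degree at most n and, G being loopless, no constant term; unless G is edgeless (when
-- q(G) = x^n has a single term) its x^n coefficient vanishes too. So n − 1 nonzero terms force
-- every coefficient of x, …, x^(n−1) to be nonzero. Expanding along an edge ab,
-- q(G) = q(G − a) + q(G^ab − b) with summands of order n − 1, whose x^(n−1) coefficients vanish
-- unless the summand is edgeless; so every edge of G meets a or, undoing the pivot, b. A vertex
-- not adjacent to this centre would be isolated, and an isolated vertex kills the coefficient of
-- x; so G is a star. Pivoting a star on one of its edges changes nothing, which gives
-- q(K_{1,m+1}) = x^(m+1) + q(K_{1,m}) and hence q(G) = 2x + x^2 + ⋯ + x^(n−1).

open import Defs
open import Data.Bool using (Bool; true; false; not; _∧_; _∨_; _xor_; T?)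
open import Data.Bool.Properties using (¬-not; not-¬; T-≡; xor-same; xor-identityʳ)
open import Data.Empty using (⊥; ⊥-elim)
open import Data.Fin using (Fin; zero; suc; _≟_; punchIn; punchOut)
open import Data.Fin.Permutation using (transpose)
open import Data.Fin.Properties using (punchIn-injective; punchInᵢ≢i; punchIn-punchOut)
open import Data.Integer using (+_; _+_) renaming (_≟_ to _≟ℤ_)
import Data.Integer.Properties as ℤ
open import Data.List using ([]; _∷_; replicate; cartesianProduct; allFin)
open import Data.List.Membership.Propositional using (_∈_)
open import Data.List.Membership.Propositional.Properties
  using (∈-filter⁺; ∈-filter⁻; ∈-cartesianProduct⁺; ∈-allFin)
open import Data.List.Relation.Unary.Any using (here)
open import Data.List.Relation.Unary.Any.Properties using (¬Any[])
open import Data.Maybe using (just; nothing)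
open import Data.Nat using (ℕ; zero; suc; z≤n; s≤s; _≤_; _<_; _∸_)
open import Data.Nat.Properties using (≤-refl; <⇒≤; m≤n⇒m≤1+n; <-irrefl; m≤n⇒m<n∨m≡n)
open import Data.Product using (_×_; _,_; proj₁; proj₂; ∃-syntax)
open import Data.Sum using (_⊎_; inj₁; inj₂; [_,_])
open import Function using (_∘_)
open import Function.Bundles using (_↔_; Inverse; mk⇔; Equivalence)
open import Relation.Binary.PropositionalEquality as ≡
  using (_≡_; _≢_; refl; trans; cong; cong₂; subst; subst₂)
open import Relation.Nullary using (¬_; Dec; does; yes; no)
open import Relation.Nullary.Decidable using (_⊎-dec_; dec-true; dec-false; does-⇔)
open import Relation.Nullary.Negation using (contradiction)

-- Coefficients and nonzero terms

coeff-⊕ : ∀ p r i → coeff (p ⊕ r) i ≡ coeff p i + coeff r i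
coeff-⊕ []      r       i       = ≡.sym (ℤ.+-identityˡ (coeff r i))
coeff-⊕ (a ∷ p) []      zero    = ≡.sym (ℤ.+-identityʳ a)
coeff-⊕ (a ∷ p) []      (suc i) = ≡.sym (ℤ.+-identityʳ (coeff p i))
coeff-⊕ (a ∷ p) (b ∷ r) zero    = refl
coeff-⊕ (a ∷ p) (b ∷ r) (suc i) = coeff-⊕ p r i

coeff-⊕-vanishes : ∀ {p} r s i → p ≡ r ⊕ s → coeff r i ≡ + 0 → coeff s i ≡ + 0 → coeff p i ≡ + 0
coeff-⊕-vanishes r s i refl r≡0 s≡0 = trans (coeff-⊕ r s i) (cong₂ _+_ r≡0 s≡0)

⊕-comm : ∀ p r → p ⊕ r ≡ r ⊕ p
⊕-comm []      []      = refl
⊕-comm []      (b ∷ r) = refl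
⊕-comm (a ∷ p) []      = refl
⊕-comm (a ∷ p) (b ∷ r) = cong₂ _∷_ (ℤ.+-comm a b) (⊕-comm p r)

coeff-xpow-> : ∀ k i → k < i → coeff (xpow k) i ≡ + 0
coeff-xpow-> zero    (suc i) _         = refl
coeff-xpow-> (suc k) (suc i) (s≤s k<i) = coeff-xpow-> k i k<i

nonzeroTerms-xpow : ∀ k → nonzeroTerms (xpow k) ≡ 1
nonzeroTerms-xpow zero    = refl
nonzeroTerms-xpow (suc k) = nonzeroTerms-xpow k

xpow-⊕-ones : ∀ m → xpow m ⊕ replicate m (+ 1) ≡ replicate (suc m) (+ 1)
xpow-⊕-ones zero    = refl
xpow-⊕-ones (suc m) = cong (+ 1 ∷_) (xpow-⊕-ones m)

xpow-⊕-starPoly : ∀ m → xpow (suc (suc m)) ⊕ starPoly (suc (suc m)) ≡ starPoly (suc (suc (suc m)))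
xpow-⊕-starPoly m = cong (λ r → + 0 ∷ + 2 ∷ r) (xpow-⊕-ones m)

nonzeroTerms-≤ : ∀ p N → (∀ i → N ≤ i → coeff p i ≡ + 0) → nonzeroTerms p ≤ N
nonzeroTerms-≤ []      N       _ = z≤n
nonzeroTerms-≤ (a ∷ p) zero    vanish with vanish 0 z≤n
... | refl = nonzeroTerms-≤ p zero (λ i _ → vanish (suc i) z≤n)
nonzeroTerms-≤ (a ∷ p) (suc N) vanish with isZeroℤ a
... | true  = m≤n⇒m≤1+n (nonzeroTerms-≤ p N (λ i N≤i → vanish (suc i) (s≤s N≤i)))
... | false = s≤s (nonzeroTerms-≤ p N (λ i N≤i → vanish (suc i) (s≤s N≤i)))

nonzeroTerms-< : ∀ p N j → (∀ i → N ≤ i → coeff p i ≡ + 0) → j < N → coeff p j ≡ + 0 →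
                 nonzeroTerms p < N
nonzeroTerms-< []      (suc N) _       _        _         _ = s≤s z≤n
nonzeroTerms-< (a ∷ p) (suc N) zero    vanish   _         refl =
  s≤s (nonzeroTerms-≤ p N (λ i N≤i → vanish (suc i) (s≤s N≤i)))
nonzeroTerms-< (a ∷ p) (suc N) (suc j) vanish (s≤s j<N) pj≡0 with isZeroℤ a
... | true  = m≤n⇒m≤1+n (nonzeroTerms-< p N j (λ i N≤i → vanish (suc i) (s≤s N≤i)) j<N pj≡0)
... | false = s≤s (nonzeroTerms-< p N j (λ i N≤i → vanish (suc i) (s≤s N≤i)) j<N pj≡0)

maximal-nonzeroTerms⇒coeff≢0 : ∀ p N → coeff p 0 ≡ + 0 → (∀ i → N < i → coeff p i ≡ + 0) →
                               nonzeroTerms p ≡ N → ∀ j → j < N → coeff p (suc j) ≢ + 0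
maximal-nonzeroTerms⇒coeff≢0 []      N refl _      refl j ()
maximal-nonzeroTerms⇒coeff≢0 (a ∷ p) N refl vanish terms j j<N pj≡0 =
  <-irrefl terms (nonzeroTerms-< p N j (λ i N≤i → vanish (suc i) (s≤s N≤i)) j<N pj≡0)

-- The edge expansion of q and the degree bounds

Edgeless : ∀ {n} → Adj n → Set
Edgeless {n} g = (x y : Fin n) → g x y ≡ false

Loopless : ∀ {n} → Adj n → Set
Loopless {n} g = (x : Fin n) → g x x ≡ false

Isolated : ∀ {n} → Adj n → Fin n → Set
Isolated {n} g v = (y : Fin n) → g v y ≡ false × g y v ≡ false

CoveredBy : ∀ {n} → Adj n → Fin n → Set
CoveredBy {n} g c = (x y : Fin n) → g x y ≡ true → x ≡ c ⊎ y ≡ c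

IsStar : ∀ {n} → Adj n → Fin n → Set
IsStar {n} g c = (x y : Fin n) → g x y ≡ does (x ≟ c) xor does (y ≟ c)

edges-sound : ∀ {n} (g : Adj n) {a b} → (a , b) ∈ edges g → g a b ≡ true
edges-sound {n} g e∈ =
  Equivalence.to T-≡ (proj₂ (∈-filter⁻ (λ e → T? (g (proj₁ e) (proj₂ e)))
                                       {xs = cartesianProduct (allFin n) (allFin n)} e∈))

edges-complete : ∀ {n} (g : Adj n) {x y} → g x y ≡ true → (x , y) ∈ edges g
edges-complete g {x} {y} gxy =
  ∈-filter⁺ (λ e → T? (g (proj₁ e) (proj₂ e))) (∈-cartesianProduct⁺ (∈-allFin x) (∈-allFin y))
            (Equivalence.from T-≡ gxy)

data Expansion {m} (g : Adj (suc m)) : Set where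
  edgeless : Edgeless g → qAdj (suc m) g ≡ xpow (suc m) → Expansion g
  expand   : ∀ a b → g a b ≡ true →
             qAdj (suc m) g ≡ qAdj m (delete a g) ⊕ qAdj m (delete b (pivot g a b)) → Expansion g

firstEdge-edge : ∀ {n} (g : Adj n) {a b} → firstEdge g ≡ just (a , b) → g a b ≡ true
firstEdge-edge g fe with edges g in eq
firstEdge-edge g refl | _ ∷ _ = edges-sound g (subst (_ ∈_) (≡.sym eq) (here refl))

firstEdge-edgeless : ∀ {n} (g : Adj n) → firstEdge g ≡ nothing → Edgeless g
firstEdge-edgeless g fe x y with edges g in eq
... | [] = ¬-not (¬Any[] ∘ subst ((x , y) ∈_) eq ∘ edges-complete g)

expansion : ∀ {m} (g : Adj (suc m)) → Expansion g
expansion {m} g with firstEdge g in fe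
... | nothing      = edgeless (firstEdge-edgeless g fe) unfold
  where
  unfold : qAdj (suc m) g ≡ xpow (suc m)
  unfold rewrite fe = refl
... | just (a , b) = expand a b (firstEdge-edge g fe) unfold
  where
  unfold : qAdj (suc m) g ≡ qAdj m (delete a g) ⊕ qAdj m (delete b (pivot g a b))
  unfold rewrite fe = refl

qAdj-edgeless : ∀ m (g : Adj m) → Edgeless g → qAdj m g ≡ xpow m
qAdj-edgeless zero    g _ = refl
qAdj-edgeless (suc m) g E with expansion g
... | edgeless _ q≡     = q≡
... | expand a b gab _ = contradiction (E a b) (not-¬ gab)

qAdj₁-loopless : (g : Adj 1) → Loopless g → qAdj 1 g ≡ xpow 1
qAdj₁-loopless g loopless = qAdj-edgeless 1 g λ { zero zero → loopless zero }

coeff-qAdj-> : ∀ m (g : Adj m) i → m < i → coeff (qAdj m g) i ≡ + 0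
coeff-qAdj-> zero    g i m<i = coeff-xpow-> 0 i m<i
coeff-qAdj-> (suc m) g i m<i with expansion g
... | edgeless _ q≡   = trans (cong (λ p → coeff p i) q≡) (coeff-xpow-> (suc m) i m<i)
... | expand a b _ q≡ =
  coeff-⊕-vanishes (qAdj m (delete a g)) (qAdj m (delete b (pivot g a b))) i q≡
                   (coeff-qAdj-> m _ i m<i′) (coeff-qAdj-> m _ i m<i′)
  where
  m<i′ : m < i
  m<i′ = <⇒≤ m<i

coeff-qAdj-order : ∀ m (g : Adj m) {x y} → g x y ≡ true → coeff (qAdj m g) m ≡ + 0
coeff-qAdj-order zero    g {()}
coeff-qAdj-order (suc m) g {x} {y} gxy with expansion g
... | edgeless E _    = contradiction (E x y) (not-¬ gxy)
... | expand a b _ q≡ =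
  coeff-⊕-vanishes (qAdj m (delete a g)) (qAdj m (delete b (pivot g a b))) (suc m) q≡
                   (coeff-qAdj-> m _ (suc m) ≤-refl) (coeff-qAdj-> m _ (suc m) ≤-refl)

coeff-qAdj-≥ : ∀ m (g : Adj m) {x y} → g x y ≡ true → ∀ i → m ≤ i → coeff (qAdj m g) i ≡ + 0
coeff-qAdj-≥ m g gxy i m≤i with m≤n⇒m<n∨m≡n m≤i
... | inj₁ m<i  = coeff-qAdj-> m g i m<i
... | inj₂ refl = coeff-qAdj-order m g gxy

coeff-order≢0⇒Edgeless : ∀ m (g : Adj m) → coeff (qAdj m g) m ≢ + 0 → Edgeless g
coeff-order≢0⇒Edgeless m g ≢0 x y with g x y in gxy
... | false = refl
... | true  = contradiction (coeff-qAdj-order m g gxy) ≢0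

Loopless-delete : ∀ {n} (g : Adj (suc n)) a → Loopless g → Loopless (delete a g)
Loopless-delete g a loopless x = loopless (punchIn a x)

-- Pivots

Incident : ∀ {n} → Fin n → Fin n → Fin n → Set
Incident a b x = x ≡ a ⊎ x ≡ b

incident? : ∀ {n} (a b x : Fin n) → Dec (Incident a b x)
incident? a b x = (x ≟ a) ⊎-dec (x ≟ b)

-- The toggle condition in the definition of pivot, as a function of x ~ a, x ~ b, y ~ a, y ~ b.
distinctClasses : Bool → Bool → Bool → Bool → Bool
distinctClasses xa xb ya yb = (xa ∨ xb) ∧ (ya ∨ yb) ∧ not (not (xa xor ya) ∧ not (xb xor yb))

distinctClasses-refl : ∀ u w → distinctClasses u w u w ≡ false
distinctClasses-refl false false = refl
distinctClasses-refl false true  = refl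
distinctClasses-refl true  false = refl
distinctClasses-refl true  true  = refl

distinctClasses-classFourʳ : ∀ u w → distinctClasses u w false false ≡ false
distinctClasses-classFourʳ false false = refl
distinctClasses-classFourʳ false true  = refl
distinctClasses-classFourʳ true  false = refl
distinctClasses-classFourʳ true  true  = refl

distinctClasses-¬a : ∀ u w → distinctClasses false u false w ≡ false
distinctClasses-¬a false false = refl
distinctClasses-¬a false true  = refl
distinctClasses-¬a true  false = refl
distinctClasses-¬a true  true  = refl

pivot-incident : ∀ {n} (g : Adj n) {a b x y} → Incident a b x ⊎ Incident a b y →
                 pivot g a b x y ≡ g x y
pivot-incident g {a} {b} {x} {y} inc with x ≟ a | x ≟ b | y ≟ a | y ≟ b
... | yes _ | _     | _     | _     = refl
... | no _  | yes _ | _     | _     = refl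
... | no _  | no _  | yes _ | _     = refl
... | no _  | no _  | no _  | yes _ = refl
... | no x≢a | no x≢b | no y≢a | no y≢b = ⊥-elim ([ [ x≢a , x≢b ] , [ y≢a , y≢b ] ] inc)

pivot-generic : ∀ {n} (g : Adj n) {a b x y} → ¬ Incident a b x → ¬ Incident a b y →
                pivot g a b x y ≡ g x y xor distinctClasses (g a x) (g b x) (g a y) (g b y)
pivot-generic g {a} {b} {x} {y} x∉ y∉ with x ≟ a | x ≟ b | y ≟ a | y ≟ b
... | yes x≡a | _       | _       | _       = ⊥-elim (x∉ (inj₁ x≡a))
... | no _    | yes x≡b | _       | _       = ⊥-elim (x∉ (inj₂ x≡b))
... | no _    | no _    | yes y≡a | _       = ⊥-elim (y∉ (inj₁ y≡a))
... | no _    | no _    | no _    | yes y≡b = ⊥-elim (y∉ (inj₂ y≡b))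
... | no _    | no _    | no _    | no _    = refl

Loopless-pivot : ∀ {n} (g : Adj n) a b → Loopless g → Loopless (pivot g a b)
Loopless-pivot g a b loopless x with incident? a b x
... | yes x∈ = trans (pivot-incident g (inj₁ x∈)) (loopless x)
... | no x∉  = trans (pivot-generic g x∉ x∉)
                     (cong₂ _xor_ (loopless x) (distinctClasses-refl (g a x) (g b x)))

coeff-qAdj-constant : ∀ m (g : Adj (suc m)) → Loopless g → coeff (qAdj (suc m) g) 0 ≡ + 0
coeff-qAdj-constant zero    g loopless = cong (λ p → coeff p 0) (qAdj₁-loopless g loopless)
coeff-qAdj-constant (suc m) g loopless with expansion g
... | edgeless _ q≡   = cong (λ p → coeff p 0) q≡
... | expand a b _ q≡ =
  coeff-⊕-vanishes (qAdj (suc m) (delete a g)) (qAdj (suc m) (delete b (pivot g a b))) 0 q≡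
    (coeff-qAdj-constant m (delete a g) (Loopless-delete g a loopless))
    (coeff-qAdj-constant m (delete b (pivot g a b))
      (Loopless-delete (pivot g a b) b (Loopless-pivot g a b loopless)))

-- Isolated vertices and vertex covers

Loopless⇒≢ : ∀ {n} {g : Adj n} → Loopless g → ∀ {a b} → g a b ≡ true → a ≢ b
Loopless⇒≢ loopless gab refl = contradiction (loopless _) (not-¬ gab)

Isolated⇒¬Incident : ∀ {n} (g : Adj n) {v} → Isolated g v → ∀ {a b} → g a b ≡ true → ¬ Incident a b v
Isolated⇒¬Incident g isolated gab (inj₁ refl) = contradiction (proj₁ (isolated _)) (not-¬ gab)
Isolated⇒¬Incident g isolated gab (inj₂ refl) = contradiction (proj₂ (isolated _)) (not-¬ gab)

Isolated-delete : ∀ {n} (g : Adj (suc n)) {a v} → Isolated g v → (a≢v : a ≢ v) →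
                  Isolated (delete a g) (punchOut a≢v)
Isolated-delete g {a} isolated a≢v y rewrite punchIn-punchOut a≢v = isolated (punchIn a y)

Isolated-pivot : ∀ {n} (g : Adj n) {a b v} → ¬ Incident a b v → Isolated g v → Isolated (pivot g a b) v
Isolated-pivot g {a} {b} {v} v∉ isolated y with incident? a b y
... | yes y∈ = trans (pivot-incident g (inj₂ y∈)) (proj₁ (isolated y)) ,
               trans (pivot-incident g (inj₁ y∈)) (proj₂ (isolated y))
... | no y∉  = trans (pivot-generic g v∉ y∉) (cong₂ _xor_ (proj₁ (isolated y)) vy-untoggled) ,
               trans (pivot-generic g y∉ v∉) (cong₂ _xor_ (proj₂ (isolated y)) yv-untoggled)
  where
  vy-untoggled : distinctClasses (g a v) (g b v) (g a y) (g b y) ≡ false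
  vy-untoggled = cong₂ (λ u w → distinctClasses u w (g a y) (g b y))
                       (proj₂ (isolated a)) (proj₂ (isolated b))
  yv-untoggled : distinctClasses (g a y) (g b y) (g a v) (g b v) ≡ false
  yv-untoggled = trans (cong₂ (distinctClasses (g a y) (g b y)) (proj₂ (isolated a)) (proj₂ (isolated b)))
                       (distinctClasses-classFourʳ (g a y) (g b y))

Fin2-pigeonhole : (a b c : Fin 2) → a ≢ b → a ≢ c → b ≢ c → ⊥
Fin2-pigeonhole zero       zero       _          a≢b _   _   = a≢b refl
Fin2-pigeonhole (suc zero) (suc zero) _          a≢b _   _   = a≢b refl
Fin2-pigeonhole zero       (suc zero) zero       _   a≢c _   = a≢c refl
Fin2-pigeonhole zero       (suc zero) (suc zero) _   _   b≢c = b≢c refl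
Fin2-pigeonhole (suc zero) zero       zero       _   _   b≢c = b≢c refl
Fin2-pigeonhole (suc zero) zero       (suc zero) _   a≢c _   = a≢c refl

coeff-x-Isolated : ∀ m (g : Adj (suc (suc m))) {v} → Loopless g → Isolated g v →
                   coeff (qAdj (suc (suc m)) g) 1 ≡ + 0
coeff-x-Isolated zero g {v} loopless isolated with expansion g
... | edgeless _ q≡    = cong (λ p → coeff p 1) q≡
... | expand a b gab _ =
  ⊥-elim (Fin2-pigeonhole a b _ (Loopless⇒≢ loopless gab) (v∉ ∘ inj₁ ∘ ≡.sym) (v∉ ∘ inj₂ ∘ ≡.sym))
  where
  v∉ : ¬ Incident a b v
  v∉ = Isolated⇒¬Incident g isolated gab
coeff-x-Isolated (suc m) g {v} loopless isolated with expansion g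
... | edgeless _ q≡     = cong (λ p → coeff p 1) q≡
... | expand a b gab q≡ =
  coeff-⊕-vanishes (qAdj (suc (suc m)) (delete a g)) (qAdj (suc (suc m)) (delete b (pivot g a b))) 1 q≡
    (coeff-x-Isolated m (delete a g) (Loopless-delete g a loopless)
      (Isolated-delete g isolated (v∉ ∘ inj₁ ∘ ≡.sym)))
    (coeff-x-Isolated m (delete b (pivot g a b))
      (Loopless-delete (pivot g a b) b (Loopless-pivot g a b loopless))
      (Isolated-delete (pivot g a b) (Isolated-pivot g v∉ isolated) (v∉ ∘ inj₂ ∘ ≡.sym)))
  where
  v∉ : ¬ Incident a b v
  v∉ = Isolated⇒¬Incident g isolated gab

Edgeless-delete⇒CoveredBy : ∀ {n} (g : Adj (suc n)) {c} → Edgeless (delete c g) → CoveredBy g c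
Edgeless-delete⇒CoveredBy g {c} edgeless′ x y gxy with x ≟ c | y ≟ c
... | yes x≡c | _       = inj₁ x≡c
... | no _    | yes y≡c = inj₂ y≡c
... | no x≢c  | no y≢c  = contradiction g≁ (not-¬ gxy)
  where
  g≁ : g x y ≡ false
  g≁ = subst₂ (λ u w → g u w ≡ false) (punchIn-punchOut (x≢c ∘ ≡.sym)) (punchIn-punchOut (y≢c ∘ ≡.sym))
              (edgeless′ _ _)

CoveredBy-pivot : ∀ {n} (g : Adj n) {a b} → a ≢ b → CoveredBy (pivot g a b) b → CoveredBy g b
CoveredBy-pivot g {a} {b} a≢b covered x y gxy = covered x y pivot-edge
  where
  a≁ : ∀ z → z ≢ b → g a z ≡ false
  a≁ z z≢b with g a z in gaz
  ... | false = refl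
  ... | true with covered a z (trans (pivot-incident g (inj₁ (inj₁ refl))) gaz)
  ...   | inj₁ a≡b = contradiction a≡b a≢b
  ...   | inj₂ z≡b = contradiction z≡b z≢b
  pivot-edge : pivot g a b x y ≡ true
  pivot-edge with incident? a b x ⊎-dec incident? a b y
  ... | yes inc = trans (pivot-incident g inc) gxy
  ... | no ¬inc = trans (pivot-generic g x∉ y∉)
                    (cong₂ _xor_ gxy (trans (cong₂ (λ u w → distinctClasses u (g b x) w (g b y))
                                                   (a≁ x (x∉ ∘ inj₂)) (a≁ y (y∉ ∘ inj₂)))
                                             (distinctClasses-¬a (g b x) (g b y))))
    where
    x∉ : ¬ Incident a b x
    x∉ = ¬inc ∘ inj₁
    y∉ : ¬ Incident a b y
    y∉ = ¬inc ∘ inj₂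

coeff-subleading≢0⇒CoveredBy : ∀ m (g : Adj (suc m)) → Loopless g → coeff (qAdj (suc m) g) m ≢ + 0 →
                                ∃[ c ] CoveredBy g c
coeff-subleading≢0⇒CoveredBy m g loopless ≢0 with expansion g
... | edgeless E _      = zero , λ x y gxy → contradiction (E x y) (not-¬ gxy)
... | expand a b gab q≡ with coeff (qAdj m (delete a g)) m ≟ℤ + 0
...   | no ≢0ₐ = a , Edgeless-delete⇒CoveredBy g (coeff-order≢0⇒Edgeless m (delete a g) ≢0ₐ)
...   | yes ≡0ₐ = b , CoveredBy-pivot g (Loopless⇒≢ loopless gab)
                        (Edgeless-delete⇒CoveredBy (pivot g a b) (coeff-order≢0⇒Edgeless m _ ≢0ᵦ))
  where
  ≢0ᵦ : coeff (qAdj m (delete b (pivot g a b))) m ≢ + 0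
  ≢0ᵦ ≡0ᵦ = ≢0 (coeff-⊕-vanishes (qAdj m (delete a g)) (qAdj m (delete b (pivot g a b))) m q≡ ≡0ₐ ≡0ᵦ)

-- Stars

≟-punchIn : ∀ {n} {a c : Fin (suc n)} (a≢c : a ≢ c) x → does (punchIn a x ≟ c) ≡ does (x ≟ punchOut a≢c)
≟-punchIn {a = a} {c} a≢c x = does-⇔ (mk⇔ to from) (punchIn a x ≟ c) (x ≟ punchOut a≢c)
  where
  to : punchIn a x ≡ c → x ≡ punchOut a≢c
  to eq = punchIn-injective a x _ (trans eq (≡.sym (punchIn-punchOut a≢c)))
  from : x ≡ punchOut a≢c → punchIn a x ≡ c
  from refl = punchIn-punchOut a≢c

IsStar-spoke : ∀ {n} (g : Adj n) {c x} → IsStar g c → x ≢ c → g c x ≡ true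
IsStar-spoke g {c} {x} star x≢c =
  trans (star c x) (cong₂ _xor_ (dec-true (c ≟ c) refl) (dec-false (x ≟ c) x≢c))

IsStar-twins : ∀ {n} (g : Adj n) {c x y} → IsStar g c → x ≢ c → y ≢ c → ∀ z → g z x ≡ g z y
IsStar-twins g {c} {x} {y} star x≢c y≢c z =
  trans (star z x) (trans (cong (does (z ≟ c) xor_) x≟c≡y≟c) (≡.sym (star z y)))
  where
  x≟c≡y≟c : does (x ≟ c) ≡ does (y ≟ c)
  x≟c≡y≟c = trans (dec-false (x ≟ c) x≢c) (≡.sym (dec-false (y ≟ c) y≢c))

IsStar-nonadjacent : ∀ {n} (g : Adj n) {c x y} → IsStar g c → x ≢ c → y ≢ c → g x y ≡ false
IsStar-nonadjacent g {c} {x} {y} star x≢c y≢c =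
  trans (star x y) (cong₂ _xor_ (dec-false (x ≟ c) x≢c) (dec-false (y ≟ c) y≢c))

IsStar⇒Loopless : ∀ {n} (g : Adj n) {c} → IsStar g c → Loopless g
IsStar⇒Loopless g {c} star x = trans (star x x) (xor-same (does (x ≟ c)))

IsStar⇒CoveredBy : ∀ {n} (g : Adj n) {c} → IsStar g c → CoveredBy g c
IsStar⇒CoveredBy g {c} star x y gxy with x ≟ c | y ≟ c
... | yes x≡c | _       = inj₁ x≡c
... | no _    | yes y≡c = inj₂ y≡c
... | no x≢c  | no y≢c  = contradiction (IsStar-nonadjacent g star x≢c y≢c) (not-¬ gxy)

IsStar-delete : ∀ {n} (g : Adj (suc n)) {a c} → IsStar g c → (a≢c : a ≢ c) →
                IsStar (delete a g) (punchOut a≢c)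
IsStar-delete g {a} star a≢c x y = trans (star _ _) (cong₂ _xor_ (≟-punchIn a≢c x) (≟-punchIn a≢c y))

IsStar-delete-centre : ∀ {n} (g : Adj (suc n)) {c} → IsStar g c → Edgeless (delete c g)
IsStar-delete-centre g {c} star x y = IsStar-nonadjacent g star (punchInᵢ≢i c x) (punchInᵢ≢i c y)

-- The vertices off the edge ab are leaves of the star, hence twins, so the pivot toggles nothing.
IsStar-pivot : ∀ {n} (g : Adj n) {a b c} → IsStar g c → Incident a b c → IsStar (pivot g a b) c
IsStar-pivot g {a} {b} {c} star c∈ x y with incident? a b x ⊎-dec incident? a b y
... | yes inc = trans (pivot-incident g inc) (star x y)
... | no ¬inc = begin
  pivot g a b x y                                           ≡⟨ pivot-generic g x∉ y∉ ⟩
  g x y xor distinctClasses (g a x) (g b x) (g a y) (g b y) ≡⟨ cong (g x y xor_) sameClass ⟩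
  g x y xor false                                           ≡⟨ xor-identityʳ (g x y) ⟩
  g x y                                                     ≡⟨ star x y ⟩
  does (x ≟ c) xor does (y ≟ c)                             ∎
  where
  open ≡.≡-Reasoning
  x∉ : ¬ Incident a b x
  x∉ = ¬inc ∘ inj₁
  y∉ : ¬ Incident a b y
  y∉ = ¬inc ∘ inj₂
  twins : ∀ z → g z x ≡ g z y
  twins = IsStar-twins g star (λ { refl → x∉ c∈ }) (λ { refl → y∉ c∈ })
  sameClass : distinctClasses (g a x) (g b x) (g a y) (g b y) ≡ false
  sameClass = trans (cong₂ (distinctClasses (g a x) (g b x)) (≡.sym (twins a)) (≡.sym (twins b)))
                    (distinctClasses-refl (g a x) (g b x))

IsStar⇒¬Edgeless : ∀ {m} (g : Adj (suc (suc m))) {c} → IsStar g c → ¬ Edgeless g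
IsStar⇒¬Edgeless g {c} star edgeless′ =
  contradiction (edgeless′ c _) (not-¬ (IsStar-spoke g star (punchInᵢ≢i c zero)))

qAdj-IsStar : ∀ m (g : Adj (suc (suc m))) {c} → IsStar g c →
              qAdj (suc (suc m)) g ≡ starPoly (suc (suc m))
qAdj-IsStar zero g star with expansion g
... | edgeless E _    = contradiction E (IsStar⇒¬Edgeless g star)
... | expand a b _ q≡ =
  trans q≡ (cong₂ _⊕_ (qAdj₁-loopless (delete a g) (Loopless-delete g a loopless))
                      (qAdj₁-loopless (delete b (pivot g a b))
                        (Loopless-delete (pivot g a b) b (Loopless-pivot g a b loopless))))
  where
  loopless : Loopless g
  loopless = IsStar⇒Loopless g star
qAdj-IsStar (suc m) g star with expansion g
... | edgeless E _ = contradiction E (IsStar⇒¬Edgeless g star)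
... | expand a b gab q≡ with IsStar⇒CoveredBy g star a b gab
...   | inj₁ refl = trans q≡ (trans (cong₂ _⊕_ centre-deleted leaf-deleted) (xpow-⊕-starPoly m))
  where
  centre-deleted : qAdj (suc (suc m)) (delete a g) ≡ xpow (suc (suc m))
  centre-deleted = qAdj-edgeless _ (delete a g) (IsStar-delete-centre g star)
  leaf-deleted : qAdj (suc (suc m)) (delete b (pivot g a b)) ≡ starPoly (suc (suc m))
  leaf-deleted = qAdj-IsStar m (delete b (pivot g a b))
                   (IsStar-delete (pivot g a b) (IsStar-pivot g star (inj₁ refl))
                                  (Loopless⇒≢ (IsStar⇒Loopless g star) gab ∘ ≡.sym))
...   | inj₂ refl = trans q≡ (trans (cong₂ _⊕_ leaf-deleted centre-deleted)
                                    (trans (⊕-comm (starPoly (suc (suc m))) (xpow (suc (suc m))))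
                                           (xpow-⊕-starPoly m)))
  where
  leaf-deleted : qAdj (suc (suc m)) (delete a g) ≡ starPoly (suc (suc m))
  leaf-deleted = qAdj-IsStar m (delete a g)
                   (IsStar-delete g star (Loopless⇒≢ (IsStar⇒Loopless g star) gab))
  centre-deleted : qAdj (suc (suc m)) (delete b (pivot g a b)) ≡ xpow (suc (suc m))
  centre-deleted = qAdj-edgeless _ (delete b (pivot g a b))
                     (IsStar-delete-centre (pivot g a b) (IsStar-pivot g star (inj₂ refl)))

CoveredBy-nonneighbour⇒Isolated : ∀ {n} (G : SimpleGraph n) {c v} → CoveredBy (adj G) c → v ≢ c →
                                  adj G c v ≡ false → Isolated (adj G) v
CoveredBy-nonneighbour⇒Isolated G {c} {v} covered v≢c c≁v y = v≁y , trans (SimpleGraph.sym G y v) v≁y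
  where
  v≁y : adj G v y ≡ false
  v≁y with adj G v y in gvy
  ... | false = refl
  ... | true with covered v y gvy
  ...   | inj₁ v≡c  = contradiction v≡c v≢c
  ...   | inj₂ refl = trans (≡.sym gvy) (trans (SimpleGraph.sym G v c) c≁v)

CoveredBy-spoke : ∀ {m} (G : SimpleGraph (suc (suc m))) {c v} → CoveredBy (adj G) c →
                  coeff (q G) 1 ≢ + 0 → v ≢ c → adj G c v ≡ true
CoveredBy-spoke G {c} {v} covered x≢0 v≢c with adj G c v in gcv
... | true  = refl
... | false = contradiction (coeff-x-Isolated _ (adj G) (irrefl G) isolated) x≢0
  where
  isolated : Isolated (adj G) v
  isolated = CoveredBy-nonneighbour⇒Isolated G covered v≢c gcv

CoveredBy⇒IsStar : ∀ {m} (G : SimpleGraph (suc (suc m))) {c} → CoveredBy (adj G) c →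
                   coeff (q G) 1 ≢ + 0 → IsStar (adj G) c
CoveredBy⇒IsStar G {c} covered x≢0 x y with x ≟ c | y ≟ c
... | yes refl | yes refl = irrefl G x
... | yes refl | no y≢c   = CoveredBy-spoke G covered x≢0 y≢c
... | no x≢c   | yes refl = trans (SimpleGraph.sym G x y) (CoveredBy-spoke G covered x≢0 x≢c)
... | no x≢c   | no y≢c with adj G x y in gxy
...   | false = refl
...   | true  = ⊥-elim ([ x≢c , y≢c ] (covered x y gxy))

isCentre≡does : ∀ {n} (x : Fin (suc n)) → isCentre x ≡ does (x ≟ zero)
isCentre≡does zero    = refl
isCentre≡does (suc x) = refl

∧-not-∨-∧-not≡xor : ∀ u v → (u ∧ not v) ∨ (v ∧ not u) ≡ u xor v
∧-not-∨-∧-not≡xor false false = refl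
∧-not-∨-∧-not≡xor false true  = refl
∧-not-∨-∧-not≡xor true  false = refl
∧-not-∨-∧-not≡xor true  true  = refl

IsStar⇒≅ : ∀ {n} (G : SimpleGraph (suc n)) {c} → IsStar (adj G) c → star (suc n) ≅ G
IsStar⇒≅ {n} G {c} isStar = σ , λ x y →
  trans (∧-not-∨-∧-not≡xor (isCentre (to x)) (isCentre (to y)))
        (trans (cong₂ _xor_ (centre x) (centre y)) (≡.sym (isStar x y)))
  where
  σ : Fin (suc n) ↔ Fin (suc n)
  σ = transpose c zero
  open Inverse σ using (to)
  centre : ∀ x → isCentre (to x) ≡ does (x ≟ c)
  centre x = trans (isCentre≡does (to x))
                   (does-⇔ (mk⇔ (λ eq → ≡.sym (Inverse.inverseʳ σ (≡.sym eq))) (Inverse.inverseˡ σ))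
                           (to x ≟ zero) (x ≟ c))

proposition56 : (n : ℕ) → 3 ≤ n → (G : SimpleGraph n) →
    nonzeroTerms (q G) ≡ n ∸ 1 →
    (q G ≈P starPoly n) × (star n ≅ G)
proposition56 (suc (suc (suc k))) _ G terms with expansion (adj G)
... | edgeless _ q≡ = contradiction (trans (≡.sym single-term) terms) λ ()
  where
  single-term : nonzeroTerms (q G) ≡ 1
  single-term = trans (cong nonzeroTerms q≡) (nonzeroTerms-xpow (suc (suc (suc k))))
... | expand a b gab _ =
  (λ i → cong (λ p → coeff p i) (qAdj-IsStar (suc k) (adj G) isStar)) , IsStar⇒≅ G isStar
  where
  coeff≢0 : ∀ j → j < suc (suc k) → coeff (q G) (suc j) ≢ + 0
  coeff≢0 = maximal-nonzeroTerms⇒coeff≢0 (q G) (suc (suc k))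
              (coeff-qAdj-constant _ (adj G) (irrefl G)) (coeff-qAdj-≥ _ (adj G) gab) terms
  centre : ∃[ c ] CoveredBy (adj G) c
  centre = coeff-subleading≢0⇒CoveredBy _ (adj G) (irrefl G) (coeff≢0 (suc k) ≤-refl)
  isStar : IsStar (adj G) (proj₁ centre)
  isStar = CoveredBy⇒IsStar G (proj₂ centre) (coeff≢0 0 (s≤s z≤n))
proposition56 (suc (suc zero)) (s≤s (s≤s ()))
proposition56 (suc zero)       (s≤s ())
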